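{- For any integer $q\ge 3$ and any positive even integer $d$, $\chi(T_q^d,d)\ge \log_2\big(\tfrac{d}{4}+q-1\big)$.
   Context: $T_q^d$ denotes the rooted complete $(q-1)$-ary tree of depth $d$ (every non-leaf vertex has exactly $q-1$ children and all leaves are at distance $d$ from the root). For a graph $G$ and a positive integer $d$, $\chi(G,d)$ denotes the minimum number of colors in a vertex coloring of $G$ such that any two vertices at distance exactly $d$ in $G$ (graph distance) receive distinct colors. -}

module Defs where

open import Data.Nat using (ℕ; zero; suc; _+_; _*_; _^_; _≤_; _<_)
open import Data.Fin using (Fin)
open import Data.List using (List; []; _∷_; length; _++_; [_])
open import Data.Product using (Σ; ∃; ∃-syntax; _×_; _,_; proj₁)
open import Data.Sum using (_⊎_)
open import Relation.Binary.PropositionalEquality using (_≡_; _≢_)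
open import Relation.Nullary using (¬_)

record Graph : Set₁ where
  field
    V   : Set
    Adj : V → V → Set
open Graph public

data Walk (G : Graph) : V G → V G → ℕ → Set where
  nil  : ∀ {u} → Walk G u u zero
  cons : ∀ {u w v n} → Adj G u w → Walk G w v n → Walk G u v (suc n)

DistEq : (G : Graph) → V G → V G → ℕ → Set
DistEq G u v n = Walk G u v n × (∀ m → m < n → ¬ Walk G u v m)

IsDistColoring : (G : Graph) → (d k : ℕ) → (V G → Fin k) → Set
IsDistColoring G d k c = ∀ u v → DistEq G u v d → c u ≢ c v

-- Rooted complete m-ary tree of depth d (m = q - 1):
-- vertices are words over Fin m of length ≤ d (the root is [], the children of w are w ++ [i]);
-- leaves are exactly the words of length d.
TVert : ℕ → ℕ → Set
TVert m d = Σ (List (Fin m)) (λ w → length w ≤ d)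

TAdj : (m d : ℕ) → TVert m d → TVert m d → Set
TAdj m d u v = (∃[ i ] proj₁ v ≡ proj₁ u ++ [ i ]) ⊎ (∃[ i ] proj₁ u ≡ proj₁ v ++ [ i ])

T : ℕ → ℕ → Graph
T q d = record { V = TVert (q Data.Nat.∸ 1) d ; Adj = TAdj (q Data.Nat.∸ 1) d }

-- Write d = 2h; distance in the tree is |u| + |v| - 2 lcp(u, v). To points i < j of a sequence
-- of n points with heights t and labels ℓ attach the word of length 2(h - t j) that leaves the
-- all-zero spine at depth h - t i - t j through the letter ℓ i. When t is monotone with
-- t j + t l ≤ h, labels of positive points avoid 0 and labels separate points of equal
-- height, the words of (i, j) and (j, l) first differ at depth h - t j - t l, which puts them
-- at distance exactly d. So a distance-d colouring properly colours the shift graph on n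
-- points; that forces n ≤ 2^k, because j ↦ {colour of (i, j) : i < j} is injective. Taking
-- q - 1 points at height 0 with distinct labels followed by ⌈h/2⌉ points of heights 1, 2, ...
-- gives n = q - 1 + ⌈d/4⌉.
module Submission where

open import Defs
open import Data.Nat using (ℕ; zero; suc; z≤n; s≤s; s≤s⁻¹; _+_; _*_; _∸_; _^_; _<_; _≤_; _⊓_; _≤?_; ⌈_/2⌉)
open import Data.Nat.Properties hiding (_≟_; 0≢1+n)
open import Data.Nat.Divisibility using (_∣_; divides)
open import Data.Nat.Tactic.RingSolver using (solve-∀)
open import Data.Fin using (Fin; toℕ; fromℕ<; funToFin; finToFun)
open import Data.Fin.Patterns using (0F; 1F)
open import Data.Fin.Properties using (_≟_; pigeonhole; toℕ<n; toℕ-fromℕ<; finToFun-funToFin; 0≢1+n)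
open import Data.List using (List; []; _∷_; length; _++_; [_]; take; replicate)
open import Data.List.Properties using (length-++; ++-assoc; ++-identityʳ; length-take; take-all; length-replicate)
open import Data.Product using (_,_)
open import Data.Sum using (inj₁; inj₂; swap)
open import Function using (_∘_)
open import Relation.Binary.PropositionalEquality hiding ([_])
open import Relation.Nullary using (¬_; yes; no; contradiction)

module _ {k n : ℕ} (c : ℕ → ℕ → Fin k)
         (proper : ∀ {i j l} → i < j → j < l → l < n → c i j ≢ c j l) where

  incoming : ℕ → Fin k → Fin 2
  incoming j γ with anyUpTo? (λ i → c i j ≟ γ) j
  ... | yes _ = 1F
  ... | no  _ = 0F

  incoming-edge : ∀ {j l} → j < l → incoming l (c j l) ≡ 1F
  incoming-edge {j} {l} j<l with anyUpTo? (λ i → c i l ≟ c j l) l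
  ... | yes _    = refl
  ... | no  none = contradiction (j , j<l , refl) none

  ¬incoming-edge : ∀ {j l} → j < l → l < n → incoming j (c j l) ≡ 0F
  ¬incoming-edge {j} {l} j<l l<n with anyUpTo? (λ i → c i j ≟ c j l) j
  ... | yes (i , i<j , same) = contradiction same (proper i<j j<l l<n)
  ... | no  _                = refl

  incoming-codes-distinct : ∀ {j l} → j < l → l < n → funToFin (incoming j) ≢ funToFin (incoming l)
  incoming-codes-distinct {j} {l} j<l l<n same-code = 0≢1+n (begin
    0F                                        ≡⟨ ¬incoming-edge j<l l<n ⟨
    incoming j (c j l)                        ≡⟨ finToFun-funToFin (incoming j) (c j l) ⟨
    finToFun (funToFin (incoming j)) (c j l)  ≡⟨ cong (λ code → finToFun code (c j l)) same-code ⟩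
    finToFun (funToFin (incoming l)) (c j l)  ≡⟨ finToFun-funToFin (incoming l) (c j l) ⟩
    incoming l (c j l)                        ≡⟨ incoming-edge j<l ⟩
    1F                                        ∎)
    where open ≡-Reasoning

  shiftGraph-bound : n ≤ 2 ^ k
  shiftGraph-bound = ≮⇒≥ λ 2^k<n →
    let j , l , j<l , same-code = pigeonhole 2^k<n (λ x → funToFin (incoming (toℕ x)))
    in incoming-codes-distinct j<l (toℕ<n l) same-code

Tree : ℕ → ℕ → Graph
Tree m = T (suc m)

lcp : ∀ {m} → List (Fin m) → List (Fin m) → ℕ
lcp []      _       = 0
lcp (_ ∷ _) []      = 0
lcp (a ∷ u) (b ∷ v) with a ≟ b
... | yes _ = suc (lcp u v)
... | no  _ = 0

module _ {m : ℕ} where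

  lcp-self : ∀ (u : List (Fin m)) → lcp u u ≡ length u
  lcp-self []      = refl
  lcp-self (a ∷ u) with a ≟ a
  ... | yes _ = cong suc (lcp-self u)
  ... | no a≢a = contradiction refl a≢a

  lcp-++ : ∀ (p u v : List (Fin m)) → lcp (p ++ u) (p ++ v) ≡ length p + lcp u v
  lcp-++ []      u v = refl
  lcp-++ (a ∷ p) u v with a ≟ a
  ... | yes _  = cong suc (lcp-++ p u v)
  ... | no a≢a = contradiction refl a≢a

  lcp-∷≢ : ∀ {a b : Fin m} u v → a ≢ b → lcp (a ∷ u) (b ∷ v) ≡ 0
  lcp-∷≢ {a} {b} u v a≢b with a ≟ b
  ... | yes a≡b = contradiction a≡b a≢b
  ... | no  _   = refl

  lcp-[]ʳ : ∀ (u : List (Fin m)) → lcp u [] ≡ 0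
  lcp-[]ʳ []      = refl
  lcp-[]ʳ (_ ∷ _) = refl

  lcp-snoc-≤ : ∀ (u : List (Fin m)) a v → lcp (u ++ [ a ]) v ≤ suc (lcp u v)
  lcp-snoc-≤ []      a []      = z≤n
  lcp-snoc-≤ []      a (b ∷ v) with a ≟ b
  ... | yes _ = s≤s z≤n
  ... | no  _ = z≤n
  lcp-snoc-≤ (c ∷ u) a []      = z≤n
  lcp-snoc-≤ (c ∷ u) a (b ∷ v) with c ≟ b
  ... | yes _ = s≤s (lcp-snoc-≤ u a v)
  ... | no  _ = z≤n

  lcp-≤-snoc : ∀ (u : List (Fin m)) a v → lcp u v ≤ lcp (u ++ [ a ]) v
  lcp-≤-snoc []      a v       = z≤n
  lcp-≤-snoc (c ∷ u) a []      = z≤n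
  lcp-≤-snoc (c ∷ u) a (b ∷ v) with c ≟ b
  ... | yes _ = s≤s (lcp-≤-snoc u a v)
  ... | no  _ = z≤n

  length-snoc : ∀ (u : List (Fin m)) a → length (u ++ [ a ]) ≡ suc (length u)
  length-snoc u a = trans (length-++ u) (+-comm (length u) 1)

module _ {m d : ℕ} where

  vertex-≡ : ∀ {u v : List (Fin m)} → u ≡ v → (pu : length u ≤ d) (pv : length v ≤ d) →
             _≡_ {A = TVert m d} (u , pu) (v , pv)
  vertex-≡ refl pu pv = cong (_ ,_) (≤-irrelevant pu pv)

  Walk-snoc : ∀ {u w v n} → Walk (Tree m d) u w n → TAdj m d w v → Walk (Tree m d) u v (suc n)
  Walk-snoc nil        e = cons e nil
  Walk-snoc (cons e′ r) e = cons e′ (Walk-snoc r e)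

  Walk-reverse : ∀ {u v n} → Walk (Tree m d) u v n → Walk (Tree m d) v u n
  Walk-reverse nil        = nil
  Walk-reverse (cons e r) = Walk-snoc (Walk-reverse r) (swap e)

  Walk-++ : ∀ {u w v a b} → Walk (Tree m d) u w a → Walk (Tree m d) w v b → Walk (Tree m d) u v (a + b)
  Walk-++ nil        r = r
  Walk-++ (cons e l) r = cons e (Walk-++ l r)

  prefix-≤ : ∀ (p x : List (Fin m)) → length (p ++ x) ≤ d → length p ≤ d
  prefix-≤ p x px = ≤-trans (m≤m+n (length p) (length x)) (≤-trans (≤-reflexive (sym (length-++ p))) px)

  descend : ∀ p x (pp : length p ≤ d) (px : length (p ++ x) ≤ d) →
            Walk (Tree m d) (p , pp) (p ++ x , px) (length x)
  descend p []      pp px = subst (λ v → Walk (Tree m d) (p , pp) v 0) (vertex-≡ (sym (++-identityʳ p)) pp px) nil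
  descend p (a ∷ x) pp px =
    cons (inj₁ (a , refl))
         (subst (λ v → Walk (Tree m d) (p ++ [ a ] , pa) v (length x)) (vertex-≡ (++-assoc p [ a ] x) px′ px)
                (descend (p ++ [ a ]) x pa px′))
    where
      px′ : length ((p ++ [ a ]) ++ x) ≤ d
      px′ = subst (λ w → length w ≤ d) (sym (++-assoc p [ a ] x)) px
      pa : length (p ++ [ a ]) ≤ d
      pa = prefix-≤ (p ++ [ a ]) x px′

  -- Along an edge the quantity |u| + |v| - 2 lcp u v changes by at most one.
  walk-length-bound : ∀ {u v pu pv n} → Walk (Tree m d) (u , pu) (v , pv) n →
                      length u + length v ≤ n + 2 * lcp u v
  walk-length-bound {u} nil = begin
    length u + length u      ≡⟨ cong (length u +_) (sym (+-identityʳ (length u))) ⟩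
    2 * length u             ≡⟨ cong (2 *_) (lcp-self u) ⟨
    2 * lcp u u              ∎
    where open ≤-Reasoning
  walk-length-bound {u} {v} {n = suc n} (cons (inj₁ (a , refl)) rest) = s≤s⁻¹ (begin
    suc (length u + length v)          ≡⟨ cong (_+ length v) (length-snoc u a) ⟨
    length (u ++ [ a ]) + length v     ≤⟨ walk-length-bound rest ⟩
    n + 2 * lcp (u ++ [ a ]) v         ≤⟨ +-monoʳ-≤ n (*-monoʳ-≤ 2 (lcp-snoc-≤ u a v)) ⟩
    n + 2 * suc (lcp u v)              ≡⟨ cong (n +_) (*-suc 2 (lcp u v)) ⟩
    n + (2 + 2 * lcp u v)              ≡⟨ +-suc n _ ⟩
    suc (n + suc (2 * lcp u v))        ≡⟨ cong suc (+-suc n _) ⟩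
    suc (suc n + 2 * lcp u v)          ∎)
    where open ≤-Reasoning
  walk-length-bound {v = v} {n = suc n} (cons {w = w , _} (inj₂ (a , refl)) rest) = begin
    length (w ++ [ a ]) + length v     ≡⟨ cong (_+ length v) (length-snoc w a) ⟩
    suc (length w + length v)          ≤⟨ s≤s (walk-length-bound rest) ⟩
    suc (n + 2 * lcp w v)              ≤⟨ s≤s (+-monoʳ-≤ n (*-monoʳ-≤ 2 (lcp-≤-snoc w a v))) ⟩
    suc n + 2 * lcp (w ++ [ a ]) v     ∎
    where open ≤-Reasoning

  diverging-distance : ∀ p x y (pu : length (p ++ x) ≤ d) (pv : length (p ++ y) ≤ d) → lcp x y ≡ 0 →
                       DistEq (Tree m d) (p ++ x , pu) (p ++ y , pv) (length x + length y)
  diverging-distance p x y pu pv diverge = walk , no-shorter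
    where
      pp : length p ≤ d
      pp = prefix-≤ p x pu
      walk : Walk (Tree m d) (p ++ x , pu) (p ++ y , pv) (length x + length y)
      walk = Walk-++ (Walk-reverse (descend p x pp pu)) (descend p y pp pv)
      no-shorter : ∀ n → n < length x + length y → ¬ Walk (Tree m d) (p ++ x , pu) (p ++ y , pv) n
      no-shorter n n<xy w = <⇒≱ n<xy (+-cancelʳ-≤ (2 * length p) _ _ (begin
        length x + length y + 2 * length p  ≡⟨ rearrange (length p) (length x) (length y) ⟩
        (length p + length x) + (length p + length y)  ≡⟨ cong₂ _+_ (length-++ p) (length-++ p) ⟨
        length (p ++ x) + length (p ++ y)   ≤⟨ walk-length-bound w ⟩
        n + 2 * lcp (p ++ x) (p ++ y)       ≡⟨ cong (λ c → n + 2 * c) (lcp-++ p x y) ⟩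
        n + 2 * (length p + lcp x y)        ≡⟨ cong (λ c → n + 2 * (length p + c)) diverge ⟩
        n + 2 * (length p + 0)              ≡⟨ cong (λ c → n + 2 * c) (+-identityʳ (length p)) ⟩
        n + 2 * length p                    ∎))
        where
          open ≤-Reasoning
          rearrange : ∀ P X Y → X + Y + 2 * P ≡ (P + X) + (P + Y)
          rearrange = solve-∀

ray : ∀ {m} → Fin (suc m) → ℕ → List (Fin (suc m))
ray ℓ zero    = []
ray ℓ (suc r) = ℓ ∷ replicate r 0F

branchWord : ∀ {m} → ℕ → Fin (suc m) → ℕ → List (Fin (suc m))
branchWord a ℓ r = replicate a 0F ++ ray ℓ r

module _ {m : ℕ} where

  length-ray : ∀ (ℓ : Fin (suc m)) r → length (ray ℓ r) ≡ r
  length-ray ℓ zero    = refl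
  length-ray ℓ (suc r) = cong suc (length-replicate r)

  length-branchWord : ∀ a (ℓ : Fin (suc m)) r → length (branchWord a ℓ r) ≡ a + r
  length-branchWord a ℓ r = trans (length-++ (replicate a 0F)) (cong₂ _+_ (length-replicate a) (length-ray ℓ r))

  replicate-+ : ∀ a b (x : Fin (suc m)) → replicate (a + b) x ≡ replicate a x ++ replicate b x
  replicate-+ zero    b x = refl
  replicate-+ (suc a) b x = cong (x ∷_) (replicate-+ a b x)

  lcp-branchWord-ray≡0 : ∀ δ {ℓ ℓ′ : Fin (suc m)} r r′ → ℓ′ ≢ 0F → (δ ≡ 0 → ℓ ≢ ℓ′) →
                         lcp (branchWord δ ℓ r) (ray ℓ′ r′) ≡ 0
  lcp-branchWord-ray≡0 δ       {ℓ} r zero     _    _    = lcp-[]ʳ (branchWord δ ℓ r)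
  lcp-branchWord-ray≡0 zero    zero    (suc r′) _    _    = refl
  lcp-branchWord-ray≡0 zero    (suc r) (suc r′) _    ℓ≢ℓ′ = lcp-∷≢ _ _ (ℓ≢ℓ′ refl)
  lcp-branchWord-ray≡0 (suc δ) r       (suc r′) ℓ′≢0 _    = lcp-∷≢ _ _ (ℓ′≢0 ∘ sym)

module _ {m d : ℕ} where

  branchWord-distance : ∀ b δ {ℓ ℓ′ : Fin (suc m)} r r′ →
                        (pu : length (branchWord (b + δ) ℓ r) ≤ d) (pv : length (branchWord b ℓ′ r′) ≤ d) →
                        ℓ′ ≢ 0F → (δ ≡ 0 → ℓ ≢ ℓ′) →
                        DistEq (Tree (suc m) d) (branchWord (b + δ) ℓ r , pu) (branchWord b ℓ′ r′ , pv) (δ + r + r′)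
  branchWord-distance b δ {ℓ} {ℓ′} r r′ pu pv ℓ′≢0 δ≡0⇒ℓ≢ℓ′ =
    subst₂ (λ u n → DistEq (Tree (suc m) d) u (branchWord b ℓ′ r′ , pv) n)
           (vertex-≡ (sym split) pu′ pu) length-sum
           (diverging-distance (replicate b 0F) (branchWord δ ℓ r) (ray ℓ′ r′) pu′ pv
                               (lcp-branchWord-ray≡0 δ r r′ ℓ′≢0 δ≡0⇒ℓ≢ℓ′))
    where
      split : branchWord (b + δ) ℓ r ≡ replicate b 0F ++ branchWord δ ℓ r
      split = trans (cong (_++ ray ℓ r) (replicate-+ b δ 0F)) (++-assoc (replicate b 0F) _ _)
      pu′ : length (replicate b 0F ++ branchWord δ ℓ r) ≤ d
      pu′ = subst (λ w → length w ≤ d) split pu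
      length-sum : length (branchWord δ ℓ r) + length (ray ℓ′ r′) ≡ δ + r + r′
      length-sum = cong₂ _+_ (length-branchWord δ ℓ r) (length-ray ℓ′ r′)

record Admissible (m h n : ℕ) : Set where
  field
    height          : ℕ → ℕ
    label           : ℕ → Fin (suc m)
    height-mono     : ∀ {i j} → i ≤ j → height i ≤ height j
    height-sum      : ∀ {j l} → j < l → l < n → height j + height l ≤ h
    label-nonzero   : ∀ {j} → 0 < j → label j ≢ 0F
    label-separates : ∀ {i j l} → i < j → j < l → height i ≡ height l → label i ≢ label j

-- The truncation only makes vertex total; it never affects the words it is applied to.
vertex : ∀ {m d} → List (Fin m) → TVert m d
vertex {d = d} w = take d w , subst (_≤ d) (sym (length-take d w)) (m⊓n≤m d (length w))

vertex-short : ∀ {m d} (w : List (Fin m)) (pw : length w ≤ d) → vertex w ≡ (w , pw)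
vertex-short {d = d} w pw = vertex-≡ (take-all d w pw) _ pw

branch-depth-split : ∀ {ti tj tl h} → ti ≤ tl → tj + tl ≤ h → h ∸ (ti + tj) ≡ (h ∸ (tj + tl)) + (tl ∸ ti)
branch-depth-split {ti} {tj} {tl} {h} ti≤tl tjl≤h = begin
  h ∸ (ti + tj)                          ≡⟨ cong (_∸ (ti + tj)) recompose ⟨
  (b + δ) + (ti + tj) ∸ (ti + tj)        ≡⟨ m+n∸n≡m (b + δ) (ti + tj) ⟩
  b + δ                                  ∎
  where
    open ≡-Reasoning
    b = h ∸ (tj + tl)
    δ = tl ∸ ti
    recompose : (b + δ) + (ti + tj) ≡ h
    recompose = begin
      (b + δ) + (ti + tj)   ≡⟨ regroup b δ ti tj ⟩
      b + ((δ + ti) + tj)   ≡⟨ cong (λ t → b + (t + tj)) (m∸n+n≡m ti≤tl) ⟩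
      b + (tl + tj)         ≡⟨ cong (b +_) (+-comm tl tj) ⟩
      b + (tj + tl)         ≡⟨ +-comm b (tj + tl) ⟩
      (tj + tl) + b         ≡⟨ m+[n∸m]≡n tjl≤h ⟩
      h                     ∎
      where
        regroup : ∀ b δ ti tj → (b + δ) + (ti + tj) ≡ b + ((δ + ti) + tj)
        regroup = solve-∀

n+n≡n*2 : ∀ n → n + n ≡ n * 2
n+n≡n*2 = solve-∀

pair-distance-sum : ∀ {ti tj tl h} → ti ≤ tl → tj ≤ h → tl ≤ h → (tl ∸ ti) + (h ∸ tj + ti) + (h ∸ tl + tj) ≡ h * 2
pair-distance-sum {ti} {tj} {tl} {h} ti≤tl tj≤h tl≤h = begin
  (tl ∸ ti) + (h ∸ tj + ti) + (h ∸ tl + tj)   ≡⟨ regroup (tl ∸ ti) (h ∸ tj) (h ∸ tl) ti tj ⟩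
  (h ∸ tj + tj) + (h ∸ tl + (tl ∸ ti + ti))   ≡⟨ cong (λ t → (h ∸ tj + tj) + (h ∸ tl + t)) (m∸n+n≡m ti≤tl) ⟩
  (h ∸ tj + tj) + (h ∸ tl + tl)               ≡⟨ cong₂ _+_ (m∸n+n≡m tj≤h) (m∸n+n≡m tl≤h) ⟩
  h + h                                       ≡⟨ n+n≡n*2 h ⟩
  h * 2                                       ∎
  where
    open ≡-Reasoning
    regroup : ∀ δ x y ti tj → δ + (x + ti) + (y + tj) ≡ (x + tj) + (y + (δ + ti))
    regroup = solve-∀

module _ {m h n : ℕ} (A : Admissible m h n) where
  open Admissible A

  pairWord : ℕ → ℕ → List (Fin (suc m))
  pairWord i j = branchWord (h ∸ (height i + height j)) (label i) (h ∸ height j + height i)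

  pairWord-length : ∀ i j → height i + height j ≤ h → length (pairWord i j) ≤ h * 2
  pairWord-length i j tij≤h = begin
    length (pairWord i j)                    ≡⟨ length-branchWord (h ∸ (ti + tj)) (label i) _ ⟩
    h ∸ (ti + tj) + (h ∸ tj + ti)            ≡⟨ regroup (h ∸ (ti + tj)) (h ∸ tj) ti ⟩
    (h ∸ (ti + tj) + ti) + (h ∸ tj)          ≡⟨ cong (λ a → a + ti + (h ∸ tj)) peel ⟩
    (h ∸ tj ∸ ti + ti) + (h ∸ tj)            ≡⟨ cong (_+ (h ∸ tj)) (m∸n+n≡m (m+n≤o⇒m≤o∸n ti tij≤h)) ⟩
    (h ∸ tj) + (h ∸ tj)                      ≤⟨ +-mono-≤ (m∸n≤m h tj) (m∸n≤m h tj) ⟩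
    h + h                                    ≡⟨ n+n≡n*2 h ⟩
    h * 2                                    ∎
    where
      ti = height i
      tj = height j
      open ≤-Reasoning
      regroup : ∀ a x t → a + (x + t) ≡ (a + t) + x
      regroup = solve-∀
      peel : h ∸ (ti + tj) ≡ h ∸ tj ∸ ti
      peel = trans (cong (h ∸_) (+-comm ti tj)) (sym (∸-+-assoc h tj ti))

  pairWords-distance : ∀ {i j l} → i < j → j < l → l < n →
                       DistEq (Tree (suc m) (h * 2)) (vertex (pairWord i j)) (vertex (pairWord j l)) (h * 2)
  pairWords-distance {i} {j} {l} i<j j<l l<n =
    subst₂ (λ u v → DistEq (Tree (suc m) (h * 2)) u v (h * 2))
           (sym (vertex-short _ pu)) (sym (vertex-short _ pv)) words-distance
    where
      ti = height i
      tj = height j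
      tl = height l
      r  = h ∸ tj + ti
      r′ = h ∸ tl + tj
      ti≤tl : ti ≤ tl
      ti≤tl = height-mono (<⇒≤ (<-trans i<j j<l))
      tjl≤h : tj + tl ≤ h
      tjl≤h = height-sum j<l l<n
      split : h ∸ (ti + tj) ≡ (h ∸ (tj + tl)) + (tl ∸ ti)
      split = branch-depth-split ti≤tl tjl≤h
      pu : length (pairWord i j) ≤ h * 2
      pu = pairWord-length i j (≤-trans (≤-trans (+-monoˡ-≤ tj ti≤tl) (≤-reflexive (+-comm tl tj))) tjl≤h)
      pv : length (pairWord j l) ≤ h * 2
      pv = pairWord-length j l tjl≤h
      pu′ : length (branchWord (h ∸ (tj + tl) + (tl ∸ ti)) (label i) r) ≤ h * 2
      pu′ = subst (λ a → length (branchWord a (label i) r) ≤ h * 2) split pu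
      separated : tl ∸ ti ≡ 0 → label i ≢ label j
      separated tl∸ti≡0 = label-separates i<j j<l (≤-antisym ti≤tl (m∸n≡0⇒m≤n tl∸ti≡0))
      words-distance : DistEq (Tree (suc m) (h * 2)) (pairWord i j , pu) (pairWord j l , pv) (h * 2)
      words-distance =
        subst₂ (λ u n → DistEq (Tree (suc m) (h * 2)) u (pairWord j l , pv) n)
               (vertex-≡ (cong (λ a → branchWord a (label i) r) (sym split)) pu′ pu)
               (pair-distance-sum ti≤tl (m+n≤o⇒m≤o tj tjl≤h) (m+n≤o⇒n≤o tj tjl≤h))
               (branchWord-distance (h ∸ (tj + tl)) (tl ∸ ti) r r′ pu′ pv
                                    (label-nonzero (≤-<-trans z≤n i<j)) separated)

admissible-bound : ∀ {m h n k} → Admissible m h n → (c : TVert (suc m) (h * 2) → Fin k) →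
                   IsDistColoring (Tree (suc m) (h * 2)) (h * 2) k c → n ≤ 2 ^ k
admissible-bound A c proper =
  shiftGraph-bound (λ i j → c (vertex (pairWord A i j)))
                   (λ i<j j<l l<n → proper _ _ (pairWords-distance A i<j j<l l<n))

m<n∧m∸o≡n∸o⇒n≤o : ∀ o {m n} → m < n → m ∸ o ≡ n ∸ o → n ≤ o
m<n∧m∸o≡n∸o⇒n≤o zero    m<n eq = contradiction eq (<⇒≢ m<n)
m<n∧m∸o≡n∸o⇒n≤o (suc o) {zero}              _         eq = m∸n≡0⇒m≤n (sym eq)
m<n∧m∸o≡n∸o⇒n≤o (suc o) {suc m} {suc n} (s≤s m<n) eq = s≤s (m<n∧m∸o≡n∸o⇒n≤o o m<n eq)

⌈n/2⌉+⌈n/2⌉≤1+n : ∀ n → ⌈ n /2⌉ + ⌈ n /2⌉ ≤ suc n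
⌈n/2⌉+⌈n/2⌉≤1+n n = ≤-trans (+-monoʳ-≤ ⌈ n /2⌉ (⌊n/2⌋≤⌈n/2⌉ (suc n))) (≤-reflexive (⌊n/2⌋+⌈n/2⌉≡n (suc n)))

n≤⌈n/2⌉+⌈n/2⌉ : ∀ n → n ≤ ⌈ n /2⌉ + ⌈ n /2⌉
n≤⌈n/2⌉+⌈n/2⌉ n = ≤-trans (≤-reflexive (sym (⌊n/2⌋+⌈n/2⌉≡n n))) (+-monoˡ-≤ ⌈ n /2⌉ (⌊n/2⌋≤⌈n/2⌉ n))

standardSequence : ∀ m h → Admissible (suc m) h (suc (suc m) + ⌈ h /2⌉)
standardSequence m h = record
  { height          = height
  ; label           = label
  ; height-mono     = ∸-monoˡ-≤ (suc m)
  ; height-sum      = height-sum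
  ; label-nonzero   = label-nonzero
  ; label-separates = label-separates
  }
  where
    height : ℕ → ℕ
    height p = p ∸ suc m
    label : ℕ → Fin (suc (suc m))
    label p = fromℕ< (s≤s (m⊓n≤n p (suc m)))
    label-nonzero : ∀ {j} → 0 < j → label j ≢ 0F
    label-nonzero {suc j} _ eq = 1+n≢0 (trans (sym (toℕ-fromℕ< (s≤s (m⊓n≤n (suc j) (suc m))))) (cong toℕ eq))
    top : ∀ {l} → l < suc (suc m) + ⌈ h /2⌉ → height l ≤ ⌈ h /2⌉
    top {l} l<n = ≤-trans (∸-monoˡ-≤ (suc m) (s≤s⁻¹ l<n)) (≤-reflexive (m+n∸m≡n (suc m) ⌈ h /2⌉))
    height-sum : ∀ {j l} → j < l → l < suc (suc m) + ⌈ h /2⌉ → height j + height l ≤ h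
    height-sum {j} {l} j<l l<n with j ≤? suc m
    ... | yes j≤s = begin
      height j + height l  ≡⟨ cong (_+ height l) (m≤n⇒m∸n≡0 j≤s) ⟩
      height l             ≤⟨ top l<n ⟩
      ⌈ h /2⌉              ≤⟨ ⌈n/2⌉≤n h ⟩
      h                    ∎
      where open ≤-Reasoning
    ... | no  j≰s = s≤s⁻¹ (begin
      suc (height j + height l)  ≤⟨ +-monoˡ-≤ (height l) (∸-monoˡ-< j<l (<⇒≤ (≰⇒> j≰s))) ⟩
      height l + height l        ≤⟨ +-mono-≤ (top l<n) (top l<n) ⟩
      ⌈ h /2⌉ + ⌈ h /2⌉          ≤⟨ ⌈n/2⌉+⌈n/2⌉≤1+n h ⟩
      suc h                      ∎)
      where open ≤-Reasoning
    label-separates : ∀ {i j l} → i < j → j < l → height i ≡ height l → label i ≢ label j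
    label-separates {i} {j} {l} i<j j<l same-height same-label = <⇒≢ i<j (begin
      i               ≡⟨ m≤n⇒m⊓n≡m (≤-trans (<⇒≤ (<-trans i<j j<l)) l≤s) ⟨
      i ⊓ suc m       ≡⟨ toℕ-fromℕ< _ ⟨
      toℕ (label i)   ≡⟨ cong toℕ same-label ⟩
      toℕ (label j)   ≡⟨ toℕ-fromℕ< _ ⟩
      j ⊓ suc m       ≡⟨ m≤n⇒m⊓n≡m (≤-trans (<⇒≤ j<l) l≤s) ⟩
      j               ∎)
      where
        open ≡-Reasoning
        l≤s : l ≤ suc m
        l≤s = m<n∧m∸o≡n∸o⇒n≤o (suc m) (<-trans i<j j<l) same-height

mainTheorem2 : (q d : ℕ) → 3 ≤ q → 1 ≤ d → 2 ∣ d →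
    (k : ℕ) (c : V (T q d) → Fin k) → IsDistColoring (T q d) d k c →
    d + 4 * (q ∸ 1) ≤ 4 * 2 ^ k
mainTheorem2 (suc (suc (suc m))) _ (s≤s (s≤s (s≤s _))) _ (divides h refl) k c proper = begin
  h * 2 + 4 * L                ≤⟨ +-monoˡ-≤ (4 * L) (*-monoˡ-≤ 2 (n≤⌈n/2⌉+⌈n/2⌉ h)) ⟩
  (U + U) * 2 + 4 * L          ≡⟨ regroup U L ⟩
  4 * (L + U)                  ≤⟨ *-monoʳ-≤ 4 (admissible-bound (standardSequence m h) c proper) ⟩
  4 * 2 ^ k                    ∎
  where
    open ≤-Reasoning
    L = suc (suc m)
    U = ⌈ h /2⌉
    regroup : ∀ U L → (U + U) * 2 + 4 * L ≡ 4 * (L + U)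
    regroup = solve-∀
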